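{- Let $U$ be an even integral unimodular lattice of rank 32 with $\mu(U)=4$, let $\Upsilon=\frac1{\sqrt2}U$, and let $M,N$ be a polarization of $\Upsilon$ with $M,N$ even unimodular lattices, $\mu(M)=4$ and $\mu(N)\in\{2,4\}$. Then the rank 96 lattice $L(M,N,3)$ has minimum norm $6$ or $8$.
   Context: All lattices are positive definite rational lattices; $\mu(X)=\min\{(x,x):x\in X,x\ne0\}$ is the minimum norm. For $U$ even unimodular and $\Upsilon=\frac1{\sqrt2}U$, a polarization of $\Upsilon$ is a pair of integral sublattices $M,N\subseteq\Upsilon$ with $M+N=\Upsilon$ and $M\cap N=2\Upsilon$. Inside the orthogonal direct sum $\Upsilon^3$, $L(M,N,3)=L_M+L^N$ where $L_M=\{(x_1,x_2,x_3)\in M^3: x_1+x_2+x_3\in M\cap N\}$ and $L^N=\{(y,y,y):y\in N\}$. -}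

module Defs where

open import Data.Nat using (ℕ)
open import Data.Integer using (ℤ; +_)
import Data.Integer as ℤ
open import Data.Rational using (ℚ; 0ℚ; ½; _+_; _*_; -_; _≤_; _<_; _/_)
open import Data.Vec using (Vec; []; _∷_; map; zipWith; foldr; replicate; lookup)
open import Data.Product using (Σ; ∃; _×_; _,_)
open import Relation.Binary.PropositionalEquality using (_≡_; _≢_)
open import Relation.Nullary using (¬_)

V : ℕ → Set
V n = Vec ℚ n

0v : ∀ {n} → V n
0v = replicate _ 0ℚ

_+v_ : ∀ {n} → V n → V n → V n
_+v_ = zipWith _+_

-v_ : ∀ {n} → V n → V n
-v_ = map -_

_·_ : ℚ → ∀ {n} → V n → V n
c · x = map (c *_) x

dot : ∀ {n} → V n → V n → ℚ
dot x y = foldr _ _+_ 0ℚ (zipWith _*_ x y)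

Matrix : ℕ → Set
Matrix n = Vec (Vec ℚ n) n

Form : ℕ → Set
Form n = V n → V n → ℚ

formOf : ∀ {n} → Matrix n → Form n
formOf G x y = dot x (map (λ row → dot row y) G)

-- the rescaled form of (1/√2)·U : (x , y) ↦ ½ (x , y)_U
halfForm : ∀ {n} → Form n → Form n
halfForm B x y = ½ * B x y

IsInt : ℚ → Set
IsInt q = ∃ λ (z : ℤ) → q ≡ z / 1

IsEvenInt : ℚ → Set
IsEvenInt q = ∃ λ (z : ℤ) → q ≡ (+ 2 ℤ.* z) / 1

Pred : ℕ → Set₁
Pred n = V n → Set

IsSubgroup : ∀ {n} → Pred n → Set
IsSubgroup L = L 0v × (∀ x y → L x → L y → L (x +v y)) × (∀ x → L x → L (-v x))

Zn : ∀ {n} → Pred n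
Zn x = ∀ i → IsInt (lookup x i)

_⊆_ : ∀ {n} → Pred n → Pred n → Set
L ⊆ K = ∀ x → L x → K x

Symmetric : ∀ {n} → Form n → Set
Symmetric B = ∀ x y → B x y ≡ B y x

PositiveDefinite : ∀ {n} → Form n → Set
PositiveDefinite B = ∀ x → x ≢ 0v → 0ℚ < B x x

Integral : ∀ {n} → Form n → Pred n → Set
Integral B L = ∀ x y → L x → L y → IsInt (B x y)

Even : ∀ {n} → Form n → Pred n → Set
Even B L = ∀ x → L x → IsEvenInt (B x x)

Dual : ∀ {n} → Form n → Pred n → Pred n
Dual B L y = ∀ x → L x → IsInt (B y x)

-- unimodular: integral and L = L*  (L ⊆ L* is integrality)
Unimodular : ∀ {n} → Form n → Pred n → Set
Unimodular B L = Integral B L × (Dual B L ⊆ L)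

EvenUnimodular : ∀ {n} → Form n → Pred n → Set
EvenUnimodular B L = Even B L × Unimodular B L

HasMin : {W : Set} → W → (W → ℚ) → (W → Set) → ℚ → Set
HasMin {W} zero nrm L m =
  (∀ w → L w → w ≢ zero → m ≤ nrm w) × (∃ λ w → L w × w ≢ zero × nrm w ≡ m)

MinNorm : ∀ {n} → Form n → Pred n → ℚ → Set
MinNorm B L m = HasMin 0v (λ x → B x x) L m

Twice : ∀ {n} → Pred n → Pred n
Twice L x = ∃ λ z → L z × x ≡ (+ 2 / 1) · z

IsPolarization : ∀ {n} → Form n → Pred n → Pred n → Pred n → Set
IsPolarization B Υ M N =
  IsSubgroup M × IsSubgroup N × M ⊆ Υ × N ⊆ Υ
  × Integral B M × Integral B N
  × (∀ x → Υ x → ∃ λ m → ∃ λ k → M m × N k × x ≡ m +v k)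
  × (∀ x → (M x × N x) → Twice Υ x)
  × (∀ x → Twice Υ x → (M x × N x))

V3 : ℕ → Set
V3 n = V n × V n × V n

0v3 : ∀ {n} → V3 n
0v3 = 0v , 0v , 0v

norm3 : ∀ {n} → Form n → V3 n → ℚ
norm3 B (x₁ , x₂ , x₃) = B x₁ x₁ + (B x₂ x₂ + B x₃ x₃)

L_M : ∀ {n} → Pred n → Pred n → V3 n → Set
L_M M N (x₁ , x₂ , x₃) =
  M x₁ × M x₂ × M x₃ × M (x₁ +v (x₂ +v x₃)) × N (x₁ +v (x₂ +v x₃))

L^N : ∀ {n} → Pred n → V3 n → Set
L^N N (w₁ , w₂ , w₃) = ∃ λ y → N y × w₁ ≡ y × w₂ ≡ y × w₃ ≡ y

L3 : ∀ {n} → Pred n → Pred n → V3 n → Set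
L3 M N (v₁ , v₂ , v₃) =
  ∃ λ a → ∃ λ b → L_M M N a × L^N N b × (v₁ , v₂ , v₃) ≡ add3 a b
  where
    add3 : _ → _ → _
    add3 (a₁ , a₂ , a₃) (b₁ , b₂ , b₃) = a₁ +v b₁ , a₂ +v b₂ , a₃ +v b₃

{-# OPTIONS --safe #-}

-- Write a vector of L(M,N,3) as (x₁ + y, x₂ + y, x₃ + y) with (x₁, x₂, x₃) ∈ L_M and y ∈ N.
-- If no component vanishes, each is a non-zero vector of Υ, of norm at least 2, so the norm is
-- at least 6. If a component vanishes then y ∈ M, so all components lie in M and their sum in
-- M ∩ N = 2Υ: either two components are non-zero (norm at least 4 + 4) or the only non-zero one
-- lies in 2Υ (norm at least 8). Evenness of M and N and integrality of N make every norm even,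
-- and (x, -x, 0) with x ∈ M of norm 4 has norm 8, so the minimum is 6 or 8.
-- To decide which, constructively, search a finite list: positive definiteness bounds the
-- coordinates of integral vectors of bounded norm, and membership in M, N and L(M,N,3) is
-- decidable because m + k with m ∈ M, k ∈ N lies in M exactly when k ∈ 2Υ.

module Submission where

open import Defs
open import Data.Integer using (+_)
open import Data.Rational using (_/_)
open import Data.Sum using (_⊎_)

open import Algebra.Bundles using (AbelianGroup)
open import Algebra.Structures using (IsAbelianGroup)
open import Data.Empty using (⊥-elim)
open import Data.Fin using (zero; suc)
import Data.Fin.Properties as FinP
open import Data.Integer as ℤ using (ℤ; -[1+_])
import Data.Integer.Properties as ℤP
open import Data.List as List using (List; _++_; applyUpTo; cartesianProduct; cartesianProductWith)
open import Data.List.Membership.Propositional using (_∈_; lose)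
open import Data.List.Membership.Propositional.Properties
  using (∈-++⁺ˡ; ∈-++⁺ʳ; ∈-applyUpTo⁺; ∈-cartesianProduct⁺; ∈-cartesianProductWith⁺)
open import Data.List.Relation.Unary.Any using (here; any?; satisfied)
open import Data.Nat as ℕ using (ℕ; zero; suc; z≤n; s≤s)
import Data.Nat.Coprimality as Coprimality
import Data.Nat.Properties as ℕP
open import Data.Product using (∃; ∃₂; _×_; _,_; proj₁; proj₂; swap)
import Data.Product.Properties as ProductP
open import Data.Rational as ℚ using (ℚ; mkℚ; 0ℚ; 1ℚ; ½; ↧ₙ_; _+_; _*_; -_; _-_; _≤_; _<_; ∣_∣; 1/_)
import Data.Rational.Properties as ℚP
open import Data.Sum using (inj₁; inj₂)
open import Data.Vec as Vec using ([]; _∷_; lookup; replicate)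
import Data.Vec.Properties as VecP
open import Function using (_∘_; _⇔_; mk⇔)
open import Level using (0ℓ)
open import Relation.Binary.Definitions using (DecidableEquality)
open import Relation.Binary.PropositionalEquality
  using (_≡_; _≢_; refl; sym; trans; cong; cong₂; subst; subst₂; isEquivalence; module ≡-Reasoning)
open import Relation.Nullary using (Dec; yes; no; ¬?)
import Relation.Nullary.Decidable as Dec
open import Relation.Nullary.Decidable using (dec⇒maybe; map′; _×-dec_)
open import Tactic.RingSolver using (solve-∀)
import Tactic.RingSolver.Core.AlmostCommutativeRing as ACR

-- The zero test lets the normaliser drop cancelled constant coefficients such as 1 - 1.
ℚ-ring : ACR.AlmostCommutativeRing 0ℓ 0ℓ
ℚ-ring = ACR.fromCommutativeRing ℚP.+-*-commutativeRing (λ x → dec⇒maybe (0ℚ ℚP.≟ x))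

fromℤ : ℤ → ℚ
fromℤ z = z / 1

coprimeTo1 : ∀ z → Coprimality.Coprime ℤ.∣ z ∣ 1
coprimeTo1 z = Coprimality.sym (Coprimality.1-coprimeTo ℤ.∣ z ∣)

fromℤ≡mkℚ : ∀ z → fromℤ z ≡ mkℚ z 0 (coprimeTo1 z)
fromℤ≡mkℚ z = ℚP.↥p/↧p≡p _

fromℤ-+ : ∀ a b → fromℤ (a ℤ.+ b) ≡ fromℤ a + fromℤ b
fromℤ-+ a b = begin
  fromℤ (a ℤ.+ b)
    ≡⟨ cong₂ (λ x y → fromℤ (x ℤ.+ y)) (sym (ℤP.*-identityʳ a)) (sym (ℤP.*-identityʳ b)) ⟩
  mkℚ a 0 (coprimeTo1 a) + mkℚ b 0 (coprimeTo1 b)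
    ≡⟨ sym (cong₂ _+_ (fromℤ≡mkℚ a) (fromℤ≡mkℚ b)) ⟩
  fromℤ a + fromℤ b ∎
  where open ≡-Reasoning

fromℤ-mono-≤ : ∀ {a b} → a ℤ.≤ b → fromℤ a ≤ fromℤ b
fromℤ-mono-≤ {a} {b} a≤b = subst₂ _≤_ (sym (fromℤ≡mkℚ a)) (sym (fromℤ≡mkℚ b))
  (ℚ.*≤* (subst₂ ℤ._≤_ (sym (ℤP.*-identityʳ a)) (sym (ℤP.*-identityʳ b)) a≤b))

fromℤ-cancel-≤ : ∀ {a b} → fromℤ a ≤ fromℤ b → a ℤ.≤ b
fromℤ-cancel-≤ {a} {b} p with subst₂ _≤_ (fromℤ≡mkℚ a) (fromℤ≡mkℚ b) p
... | ℚ.*≤* q = subst₂ ℤ._≤_ (ℤP.*-identityʳ a) (ℤP.*-identityʳ b) q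

0≤fromℤ+ : ∀ k → 0ℚ ≤ fromℤ (+ k)
0≤fromℤ+ k = fromℤ-mono-≤ {+ 0} {+ k} (ℤ.+≤+ z≤n)

fromℤ-∣∣ : ∀ z → ∣ fromℤ z ∣ ≡ fromℤ (+ ℤ.∣ z ∣)
fromℤ-∣∣ z = trans (cong ∣_∣ (fromℤ≡mkℚ z)) (sym (fromℤ≡mkℚ (+ ℤ.∣ z ∣)))

isInt? : ∀ q → Dec (IsInt q)
isInt? (mkℚ z zero _)    = yes (z , sym (fromℤ≡mkℚ z))
isInt? (mkℚ z (suc d) _) = no λ { (z′ , eq) → 2+d≢1 (cong ↧ₙ_ (trans eq (fromℤ≡mkℚ z′))) }
  where
  2+d≢1 : suc (suc d) ≢ 1
  2+d≢1 ()

IsInt-+ : ∀ {p q} → IsInt p → IsInt q → IsInt (p + q)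
IsInt-+ (a , refl) (b , refl) = a ℤ.+ b , sym (fromℤ-+ a b)

IsEvenInt-+ : ∀ {p q} → IsEvenInt p → IsEvenInt q → IsEvenInt (p + q)
IsEvenInt-+ (a , refl) (b , refl) = a ℤ.+ b ,
  trans (sym (fromℤ-+ (+ 2 ℤ.* a) (+ 2 ℤ.* b))) (cong fromℤ (sym (ℤP.*-distribˡ-+ (+ 2) a b)))

IsEvenInt-double : ∀ {p} → IsInt p → IsEvenInt (p + p)
IsEvenInt-double (a , refl) = a , trans (sym (fromℤ-+ a a)) (cong fromℤ (a+a≡2a a))
  where
  a+a≡2a : ∀ a → a ℤ.+ a ≡ + 2 ℤ.* a
  a+a≡2a a = trans (cong₂ ℤ._+_ (sym (ℤP.*-identityˡ a)) (sym (ℤP.*-identityˡ a)))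
                   (sym (ℤP.*-distribʳ-+ a (+ 1) (+ 1)))

+v-isAbelianGroup : ∀ {n} → IsAbelianGroup _≡_ (_+v_ {n}) 0v -v_
+v-isAbelianGroup = record
  { isGroup = record
    { isMonoid = record
      { isSemigroup = record
        { isMagma = record { isEquivalence = isEquivalence ; ∙-cong = cong₂ _+v_ }
        ; assoc = VecP.zipWith-assoc ℚP.+-assoc }
      ; identity = VecP.zipWith-identityˡ ℚP.+-identityˡ , VecP.zipWith-identityʳ ℚP.+-identityʳ }
    ; inverse = VecP.zipWith-inverseˡ ℚP.+-inverseˡ , VecP.zipWith-inverseʳ ℚP.+-inverseʳ
    ; ⁻¹-cong = cong -v_ }
  ; comm = VecP.zipWith-comm ℚP.+-comm }

+v-abelianGroup : ℕ → AbelianGroup 0ℓ 0ℓ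
+v-abelianGroup n = record { isAbelianGroup = +v-isAbelianGroup {n} }

module +v {n : ℕ} where
  open AbelianGroup (+v-abelianGroup n) public
  open import Algebra.Properties.AbelianGroup (+v-abelianGroup n) public

·-assoc : ∀ {n} c d (x : V n) → c · (d · x) ≡ (c * d) · x
·-assoc c d x = trans (sym (VecP.map-∘ (c *_) (d *_) x)) (VecP.map-cong (λ a → sym (ℚP.*-assoc c d a)) x)

·-identityˡ : ∀ {n} (x : V n) → 1ℚ · x ≡ x
·-identityˡ x = trans (VecP.map-cong ℚP.*-identityˡ x) (VecP.map-id x)

·-zeroʳ : ∀ {n} c → c · 0v {n} ≡ 0v
·-zeroʳ c = trans (VecP.map-replicate (c *_) 0ℚ _) (cong (replicate _) (ℚP.*-zeroʳ c))

-v≡-1· : ∀ {n} (x : V n) → -v x ≡ (- 1ℚ) · x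
-v≡-1· = VecP.map-cong neg≡-1*
  where
  neg≡-1* : ∀ a → - a ≡ (- 1ℚ) * a
  neg≡-1* = solve-∀ ℚ-ring

dot-addˡ : ∀ {n} (x y w : V n) → dot (x +v y) w ≡ dot x w + dot y w
dot-addˡ []      []      []      = sym (ℚP.+-identityˡ 0ℚ)
dot-addˡ (a ∷ x) (b ∷ y) (c ∷ w) rewrite dot-addˡ x y w = distrib a b c (dot x w) (dot y w)
  where
  distrib : ∀ a b c p q → (a + b) * c + (p + q) ≡ (a * c + p) + (b * c + q)
  distrib = solve-∀ ℚ-ring

dot-scaleˡ : ∀ {n} c (x w : V n) → dot (c · x) w ≡ c * dot x w
dot-scaleˡ c []      []      = sym (ℚP.*-zeroʳ c)
dot-scaleˡ c (a ∷ x) (b ∷ w) rewrite dot-scaleˡ c x w = distrib c a b (dot x w)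
  where
  distrib : ∀ c a b p → (c * a) * b + c * p ≡ c * (a * b + p)
  distrib = solve-∀ ℚ-ring

record IsSymBilinear {n} (B : Form n) : Set where
  field
    addˡ      : ∀ x y z → B (x +v y) z ≡ B x z + B y z
    scaleˡ    : ∀ c x z → B (c · x) z ≡ c * B x z
    symmetric : Symmetric B

  open ≡-Reasoning

  addʳ : ∀ x y z → B x (y +v z) ≡ B x y + B x z
  addʳ x y z = begin
    B x (y +v z)    ≡⟨ symmetric x _ ⟩
    B (y +v z) x    ≡⟨ addˡ y z x ⟩
    B y x + B z x   ≡⟨ cong₂ _+_ (symmetric y x) (symmetric z x) ⟩
    B x y + B x z   ∎

  scaleʳ : ∀ c x z → B z (c · x) ≡ c * B z x
  scaleʳ c x z = trans (symmetric z _) (trans (scaleˡ c x z) (cong (c *_) (symmetric x z)))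

  zeroˡ : ∀ z → B 0v z ≡ 0ℚ
  zeroˡ z = begin
    B 0v z          ≡⟨ cong (λ v → B v z) (sym (·-zeroʳ 0ℚ)) ⟩
    B (0ℚ · 0v) z   ≡⟨ scaleˡ 0ℚ 0v z ⟩
    0ℚ * B 0v z     ≡⟨ ℚP.*-zeroˡ (B 0v z) ⟩
    0ℚ              ∎

  norm-scale : ∀ c x → B (c · x) (c · x) ≡ c * (c * B x x)
  norm-scale c x = trans (scaleˡ c x _) (cong (c *_) (scaleʳ c x x))

  norm-neg : ∀ x → B (-v x) (-v x) ≡ B x x
  norm-neg x = begin
    B (-v x) (-v x)                ≡⟨ cong (λ v → B v v) (-v≡-1· x) ⟩
    B ((- 1ℚ) · x) ((- 1ℚ) · x)    ≡⟨ norm-scale (- 1ℚ) x ⟩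
    (- 1ℚ) * ((- 1ℚ) * B x x)      ≡⟨ -1*-1* (B x x) ⟩
    B x x                          ∎
    where
    -1*-1* : ∀ a → (- 1ℚ) * ((- 1ℚ) * a) ≡ a
    -1*-1* = solve-∀ ℚ-ring

  norm-+ : ∀ x y → B (x +v y) (x +v y) ≡ B x x + ((B x y + B x y) + B y y)
  norm-+ x y = begin
    B (x +v y) (x +v y)                 ≡⟨ addˡ x y _ ⟩
    B x (x +v y) + B y (x +v y)         ≡⟨ cong₂ _+_ (addʳ x x y) (addʳ y x y) ⟩
    (B x x + B x y) + (B y x + B y y)   ≡⟨ cong (λ b → (B x x + B x y) + (b + B y y)) (symmetric y x) ⟩
    (B x x + B x y) + (B x y + B y y)   ≡⟨ regroup (B x x) (B x y) (B y y) ⟩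
    B x x + ((B x y + B x y) + B y y)   ∎
    where
    regroup : ∀ a b c → (a + b) + (b + c) ≡ a + ((b + b) + c)
    regroup = solve-∀ ℚ-ring

formOf-isSymBilinear : ∀ {n} (G : Matrix n) → Symmetric (formOf G) → IsSymBilinear (formOf G)
formOf-isSymBilinear G sym-G = record
  { addˡ      = λ x y _ → dot-addˡ x y _
  ; scaleˡ    = λ c x _ → dot-scaleˡ c x _
  ; symmetric = sym-G
  }

halfForm-isSymBilinear : ∀ {n} {B : Form n} → IsSymBilinear B → IsSymBilinear (halfForm B)
halfForm-isSymBilinear {B = B} bil = record
  { addˡ      = λ x y z → trans (cong (½ *_) (addˡ x y z)) (ℚP.*-distribˡ-+ ½ (B x z) (B y z))
  ; scaleˡ    = λ c x z → trans (cong (½ *_) (scaleˡ c x z)) (½-swap c (B x z))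
  ; symmetric = λ x y → cong (½ *_) (symmetric x y)
  }
  where
  open IsSymBilinear bil
  ½-swap : ∀ c b → ½ * (c * b) ≡ c * (½ * b)
  ½-swap = solve-∀ ℚ-ring

≤-+-nonNegˡ : ∀ {p q} → 0ℚ ≤ p → q ≤ p + q
≤-+-nonNegˡ {p} {q} 0≤p = subst (_≤ p + q) (ℚP.+-identityˡ q) (ℚP.+-monoˡ-≤ q 0≤p)

≤-+-nonNegʳ : ∀ {p q} → 0ℚ ≤ q → p ≤ p + q
≤-+-nonNegʳ {p} {q} 0≤q = subst (_≤ p + q) (ℚP.+-identityʳ p) (ℚP.+-monoʳ-≤ p 0≤q)

*-nonNeg : ∀ {p q} → 0ℚ ≤ p → 0ℚ ≤ q → 0ℚ ≤ p * q
*-nonNeg {p} {q} 0≤p 0≤q = ℚP.nonNegative⁻¹ (p * q)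
  {{ℚP.nonNeg*nonNeg⇒nonNeg p {{ℚ.nonNegative 0≤p}} q {{ℚ.nonNegative 0≤q}}}}

*-monoˡ-≤-nonNeg : ∀ {p q} r → 0ℚ ≤ r → p ≤ q → r * p ≤ r * q
*-monoˡ-≤-nonNeg r 0≤r = ℚP.*-monoˡ-≤-nonNeg r {{ℚ.nonNegative 0≤r}}

*-monoʳ-≤-nonNeg : ∀ {p q} r → 0ℚ ≤ r → p ≤ q → p * r ≤ q * r
*-monoʳ-≤-nonNeg r 0≤r = ℚP.*-monoʳ-≤-nonNeg r {{ℚ.nonNegative 0≤r}}

p*p≡∣p∣*∣p∣ : ∀ p → p * p ≡ ∣ p ∣ * ∣ p ∣
p*p≡∣p∣*∣p∣ p with ℚP.∣p∣≡p∨∣p∣≡-p p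
... | inj₁ ∣p∣≡p  = cong (λ q → q * q) (sym ∣p∣≡p)
... | inj₂ ∣p∣≡-p = trans (-p*-p≡p*p p) (cong (λ q → q * q) (sym ∣p∣≡-p))
  where
  -p*-p≡p*p : ∀ p → p * p ≡ (- p) * (- p)
  -p*-p≡p*p = solve-∀ ℚ-ring

p≤1+p*p : ∀ {p} → 0ℚ ≤ p → p ≤ 1ℚ + p * p
p≤1+p*p {p} 0≤p with p ℚ.≤? 1ℚ
... | yes p≤1 = ℚP.≤-trans p≤1 (≤-+-nonNegʳ (*-nonNeg 0≤p 0≤p))
... | no  p≰1 = ℚP.≤-trans p≤p*p (≤-+-nonNegˡ (ℚP.nonNegative⁻¹ 1ℚ))
  where
  p≤p*p : p ≤ p * p
  p≤p*p = subst (_≤ p * p) (ℚP.*-identityˡ p) (*-monoʳ-≤-nonNeg p 0≤p (ℚP.<⇒≤ (ℚP.≰⇒> p≰1)))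

norm-nonNeg : ∀ {n} {B : Form n} → IsSymBilinear B → PositiveDefinite B → ∀ x → 0ℚ ≤ B x x
norm-nonNeg bil pd x with VecP.≡-dec ℚP._≟_ x 0v
... | yes refl = ℚP.≤-reflexive (sym (IsSymBilinear.zeroˡ bil 0v))
... | no  x≢0  = ℚP.<⇒≤ (pd x x≢0)

Linear : ∀ {m} → (V m → ℚ) → Set
Linear ℓ = (∀ x y → ℓ (x +v y) ≡ ℓ x + ℓ y) × (∀ c x → ℓ (c · x) ≡ c * ℓ x)

InBox : ∀ {m} → ℚ → V m → Set
InBox K x = ∀ i → ∣ lookup x i ∣ ≤ K

e₀ : ∀ {m} → V (suc m)
e₀ = 1ℚ ∷ 0v

split-head : ∀ {m} y (ys : V m) → y ∷ ys ≡ (y · e₀) +v (0ℚ ∷ ys)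
split-head y ys = cong₂ _∷_ (sym (trans (ℚP.+-identityʳ (y * 1ℚ)) (ℚP.*-identityʳ y)))
  (sym (trans (cong (_+v ys) (·-zeroʳ y)) (+v.identityˡ ys)))

restrict-linear : ∀ {m} {ℓ : V (suc m) → ℚ} → Linear ℓ → Linear (λ x → ℓ (0ℚ ∷ x))
restrict-linear {ℓ = ℓ} (add , scale) =
    (λ x y → trans (cong (λ h → ℓ (h ∷ (x +v y))) (sym (ℚP.+-identityˡ 0ℚ))) (add (0ℚ ∷ x) (0ℚ ∷ y)))
  , (λ c x → trans (cong (λ h → ℓ (h ∷ (c · x))) (sym (ℚP.*-zeroʳ c))) (scale c (0ℚ ∷ x)))

*-linear : ∀ {m} {ℓ : V m → ℚ} c → Linear ℓ → Linear (λ x → ℓ x * c)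
*-linear {ℓ = ℓ} c (add , scale) =
    (λ x y → trans (cong (_* c) (add x y)) (ℚP.*-distribʳ-+ c (ℓ x) (ℓ y)))
  , (λ d x → trans (cong (_* c) (scale d x)) (ℚP.*-assoc d (ℓ x) c))

linear-bounded-on-box : ∀ m (ℓ : V m → ℚ) → Linear ℓ → ∀ K → 0ℚ ≤ K →
                        ∃ λ D → ∀ x → InBox K x → ∣ ℓ x ∣ ≤ D
linear-bounded-on-box zero ℓ (_ , scale) K _ = 0ℚ , λ { [] _ → ℚP.≤-reflexive (cong ∣_∣ ℓ[]≡0) }
  where
  ℓ[]≡0 : ℓ [] ≡ 0ℚ
  ℓ[]≡0 = trans (scale 0ℚ []) (ℚP.*-zeroˡ (ℓ []))
linear-bounded-on-box (suc m) ℓ lin@(add , scale) K 0≤K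
  with linear-bounded-on-box m (λ x → ℓ (0ℚ ∷ x)) (restrict-linear lin) K 0≤K
... | D , ℓ′-bounded = K * ∣ ℓ e₀ ∣ + D , bound
  where
  ℓ′ : V m → ℚ
  ℓ′ x = ℓ (0ℚ ∷ x)
  bound : ∀ x → InBox K x → ∣ ℓ x ∣ ≤ K * ∣ ℓ e₀ ∣ + D
  bound (y ∷ ys) y∷ys∈box = begin
    ∣ ℓ (y ∷ ys) ∣              ≡⟨ cong ∣_∣ (trans (cong ℓ (split-head y ys)) (trans (add _ _) (cong (_+ ℓ′ ys) (scale y e₀)))) ⟩
    ∣ y * ℓ e₀ + ℓ′ ys ∣        ≤⟨ ℚP.∣p+q∣≤∣p∣+∣q∣ (y * ℓ e₀) (ℓ′ ys) ⟩
    ∣ y * ℓ e₀ ∣ + ∣ ℓ′ ys ∣    ≡⟨ cong (_+ ∣ ℓ′ ys ∣) (ℚP.∣p*q∣≡∣p∣*∣q∣ y (ℓ e₀)) ⟩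
    ∣ y ∣ * ∣ ℓ e₀ ∣ + ∣ ℓ′ ys ∣
      ≤⟨ ℚP.+-mono-≤ (*-monoʳ-≤-nonNeg ∣ ℓ e₀ ∣ (ℚP.0≤∣p∣ (ℓ e₀)) (y∷ys∈box zero))
                     (ℓ′-bounded ys (y∷ys∈box ∘ suc)) ⟩
    K * ∣ ℓ e₀ ∣ + D            ∎
    where open ℚP.≤-Reasoning

module CompletingTheSquare {m} {B : Form (suc m)} (bil : IsSymBilinear B) (pd : PositiveDefinite B) where
  open IsSymBilinear bil
  open ≡-Reasoning

  a : ℚ
  a = B e₀ e₀

  0<a : 0ℚ < a
  0<a = pd e₀ (λ e₀≡0 → ℚP.1≢0 (cong Vec.head e₀≡0))

  instance
    a-positive : ℚ.Positive a
    a-positive = ℚ.positive 0<a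

  a⁻¹ : ℚ
  a⁻¹ = (1/ a) {{ℚP.pos⇒nonZero a}}

  0≤a⁻¹ : 0ℚ ≤ a⁻¹
  0≤a⁻¹ = ℚP.nonNegative⁻¹ a⁻¹ {{ℚP.pos⇒nonNeg a⁻¹ {{ℚP.1/pos⇒pos a}}}}

  a⁻¹*a≡1 : a⁻¹ * a ≡ 1ℚ
  a⁻¹*a≡1 = ℚP.*-inverseˡ a {{ℚP.pos⇒nonZero a}}

  s : V m → ℚ
  s x = B e₀ (0ℚ ∷ x) * a⁻¹

  s-linear : Linear s
  s-linear = *-linear a⁻¹ (restrict-linear (addʳ e₀ , λ c x → scaleʳ c x e₀))

  -- φ parametrises the B-orthogonal complement of e₀ by the last m coordinates.
  φ : V m → V (suc m)
  φ x = (- s x) ∷ x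

  φ-+ : ∀ x y → φ (x +v y) ≡ φ x +v φ y
  φ-+ x y = cong (_∷ (x +v y)) (trans (cong -_ (proj₁ s-linear x y)) (ℚP.neg-distrib-+ (s x) (s y)))

  φ-· : ∀ c x → φ (c · x) ≡ c · φ x
  φ-· c x = cong (_∷ (c · x)) (trans (cong -_ (proj₂ s-linear c x)) (ℚP.neg-distribʳ-* c (s x)))

  B′ : Form m
  B′ x y = B (φ x) (φ y)

  B′-isSymBilinear : IsSymBilinear B′
  B′-isSymBilinear = record
    { addˡ      = λ x y z → trans (cong (λ v → B v (φ z)) (φ-+ x y)) (addˡ (φ x) (φ y) (φ z))
    ; scaleˡ    = λ c x z → trans (cong (λ v → B v (φ z)) (φ-· c x)) (scaleˡ c (φ x) (φ z))
    ; symmetric = λ x y → symmetric (φ x) (φ y)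
    }

  B′-positiveDefinite : PositiveDefinite B′
  B′-positiveDefinite x x≢0 = pd (φ x) (λ φx≡0 → x≢0 (cong Vec.tail φx≡0))

  e₀⊥φ : ∀ x → B e₀ (φ x) ≡ 0ℚ
  e₀⊥φ x = begin
    B e₀ (φ x)                                  ≡⟨ cong (B e₀) (split-head (- s x) x) ⟩
    B e₀ (((- s x) · e₀) +v (0ℚ ∷ x))           ≡⟨ addʳ e₀ _ _ ⟩
    B e₀ ((- s x) · e₀) + B e₀ (0ℚ ∷ x)         ≡⟨ cong (_+ B e₀ (0ℚ ∷ x)) (scaleʳ (- s x) e₀ e₀) ⟩
    - (B e₀ (0ℚ ∷ x) * a⁻¹) * a + B e₀ (0ℚ ∷ x) ≡⟨ cancel (B e₀ (0ℚ ∷ x)) a⁻¹ a ⟩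
    - (B e₀ (0ℚ ∷ x) * (a⁻¹ * a)) + B e₀ (0ℚ ∷ x) ≡⟨ cong (λ c → - (B e₀ (0ℚ ∷ x) * c) + B e₀ (0ℚ ∷ x)) a⁻¹*a≡1 ⟩
    - (B e₀ (0ℚ ∷ x) * 1ℚ) + B e₀ (0ℚ ∷ x)      ≡⟨ vanish (B e₀ (0ℚ ∷ x)) ⟩
    0ℚ                                          ∎
    where
    cancel : ∀ t i a → - (t * i) * a + t ≡ - (t * (i * a)) + t
    cancel = solve-∀ ℚ-ring
    vanish : ∀ t → - (t * 1ℚ) + t ≡ 0ℚ
    vanish = solve-∀ ℚ-ring

  norm-completed : ∀ x₁ x → B (x₁ ∷ x) (x₁ ∷ x) ≡ a * (∣ x₁ + s x ∣ * ∣ x₁ + s x ∣) + B′ x x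
  norm-completed x₁ x = begin
    B (x₁ ∷ x) (x₁ ∷ x)                          ≡⟨ cong (λ v → B v v) x₁∷x≡u·e₀+φx ⟩
    B ((u · e₀) +v φ x) ((u · e₀) +v φ x)            ≡⟨ norm-+ (u · e₀) (φ x) ⟩
    B (u · e₀) (u · e₀) + ((B (u · e₀) (φ x) + B (u · e₀) (φ x)) + B′ x x)
      ≡⟨ cong₂ (λ p q → p + ((q + q) + B′ x x)) (norm-scale u e₀) (trans (scaleˡ u e₀ (φ x)) (cong (u *_) (e₀⊥φ x))) ⟩
    u * (u * a) + ((u * 0ℚ + u * 0ℚ) + B′ x x)   ≡⟨ collect u a (B′ x x) ⟩
    a * (u * u) + B′ x x                         ≡⟨ cong (λ q → a * q + B′ x x) (p*p≡∣p∣*∣p∣ u) ⟩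
    a * (∣ u ∣ * ∣ u ∣) + B′ x x                 ∎
    where
    u = x₁ + s x
    x₁∷x≡u·e₀+φx : x₁ ∷ x ≡ (u · e₀) +v φ x
    x₁∷x≡u·e₀+φx = cong₂ _∷_ (shift x₁ (s x)) (sym (trans (cong (_+v x) (·-zeroʳ u)) (+v.identityˡ x)))
      where
      shift : ∀ x₁ s → x₁ ≡ (x₁ + s) * 1ℚ + - s
      shift = solve-∀ ℚ-ring
    collect : ∀ u a r → u * (u * a) + ((u * 0ℚ + u * 0ℚ) + r) ≡ a * (u * u) + r
    collect = solve-∀ ℚ-ring

ℕ-above : ∀ q → ∃ λ k → q ≤ fromℤ (+ k)
ℕ-above q@(mkℚ z d _) = ℤ.∣ z ∣ , subst (q ≤_) (sym (fromℤ≡mkℚ (+ ℤ.∣ z ∣))) (ℚ.*≤* (z≤∣z∣*d z))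
  where
  z≤∣z∣*d : ∀ z → z ℤ.* + 1 ℤ.≤ + ℤ.∣ z ∣ ℤ.* + suc d
  z≤∣z∣*d (+ n)    = subst₂ ℤ._≤_ (sym (ℤP.*-identityʳ (+ n))) (ℤP.pos-* n (suc d)) (ℤ.+≤+ (ℕP.m≤m*n n (suc d)))
  z≤∣z∣*d -[1+ n ] = subst (ℤ._≤ (+ ℤ.∣ -[1+ n ] ∣ ℤ.* + suc d)) (sym (ℤP.*-identityʳ -[1+ n ])) ℤ.-≤+

bounded-norm⇒bounded-coordinates : ∀ n {B : Form n} → IsSymBilinear B → PositiveDefinite B →
                                    ∀ C → ∃ λ K → ∀ x → B x x ≤ C → InBox (fromℤ (+ K)) x
bounded-norm⇒bounded-coordinates zero    bil pd C = 0 , λ _ _ ()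
bounded-norm⇒bounded-coordinates (suc m) {B} bil pd C = K′ ℕ.⊔ k , inBox
  where
  open CompletingTheSquare bil pd

  K′ : ℕ
  K′ = proj₁ (bounded-norm⇒bounded-coordinates m B′-isSymBilinear B′-positiveDefinite C)

  B′-bounded⇒inBox : ∀ x → B′ x x ≤ C → InBox (fromℤ (+ K′)) x
  B′-bounded⇒inBox = proj₂ (bounded-norm⇒bounded-coordinates m B′-isSymBilinear B′-positiveDefinite C)

  D : ℚ
  D = proj₁ (linear-bounded-on-box m s s-linear (fromℤ (+ K′)) (0≤fromℤ+ K′))

  s-bounded : ∀ x → InBox (fromℤ (+ K′)) x → ∣ s x ∣ ≤ D
  s-bounded = proj₂ (linear-bounded-on-box m s s-linear (fromℤ (+ K′)) (0≤fromℤ+ K′))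

  R : ℚ
  R = (1ℚ + a⁻¹ * C) + D

  k : ℕ
  k = proj₁ (ℕ-above R)

  inBox : ∀ x → B x x ≤ C → InBox (fromℤ (+ (K′ ℕ.⊔ k))) x
  inBox (x₁ ∷ x) Bx≤C = λ
    { zero    → ℚP.≤-trans ∣x₁∣≤R (ℚP.≤-trans (proj₂ (ℕ-above R)) (fromℤ-mono-≤ (ℤ.+≤+ (ℕP.m≤n⊔m K′ k))))
    ; (suc i) → ℚP.≤-trans (x∈box i) (fromℤ-mono-≤ (ℤ.+≤+ (ℕP.m≤m⊔n K′ k)))
    }
    where
    u = x₁ + s x
    0≤a∣u∣² : 0ℚ ≤ a * (∣ u ∣ * ∣ u ∣)
    0≤a∣u∣² = *-nonNeg (ℚP.<⇒≤ 0<a) (*-nonNeg (ℚP.0≤∣p∣ u) (ℚP.0≤∣p∣ u))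
    split≤C : a * (∣ u ∣ * ∣ u ∣) + B′ x x ≤ C
    split≤C = subst (_≤ C) (norm-completed x₁ x) Bx≤C
    x∈box : InBox (fromℤ (+ K′)) x
    x∈box = B′-bounded⇒inBox x (ℚP.≤-trans (≤-+-nonNegˡ 0≤a∣u∣²) split≤C)
    ∣u∣²≤a⁻¹C : ∣ u ∣ * ∣ u ∣ ≤ a⁻¹ * C
    ∣u∣²≤a⁻¹C = subst (_≤ a⁻¹ * C) (trans (reassoc a⁻¹ a (∣ u ∣ * ∣ u ∣))
                  (trans (cong (_* (∣ u ∣ * ∣ u ∣)) a⁻¹*a≡1) (ℚP.*-identityˡ _)))
      (*-monoˡ-≤-nonNeg a⁻¹ 0≤a⁻¹ (ℚP.≤-trans (≤-+-nonNegʳ (norm-nonNeg B′-isSymBilinear B′-positiveDefinite x)) split≤C))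
      where
      reassoc : ∀ i a q → i * (a * q) ≡ (i * a) * q
      reassoc = solve-∀ ℚ-ring
    ∣x₁∣≤R : ∣ x₁ ∣ ≤ R
    ∣x₁∣≤R = begin
      ∣ x₁ ∣           ≡⟨ cong ∣_∣ (x₁≡u-s x₁ (s x)) ⟩
      ∣ u - s x ∣      ≤⟨ ℚP.∣p-q∣≤∣p∣+∣q∣ u (s x) ⟩
      ∣ u ∣ + ∣ s x ∣  ≤⟨ ℚP.+-mono-≤ (ℚP.≤-trans (p≤1+p*p (ℚP.0≤∣p∣ u)) (ℚP.+-monoʳ-≤ 1ℚ ∣u∣²≤a⁻¹C))
                                      (s-bounded x x∈box) ⟩
      R                ∎
      where
      open ℚP.≤-Reasoning
      x₁≡u-s : ∀ x₁ s → x₁ ≡ (x₁ + s) - s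
      x₁≡u-s = solve-∀ ℚ-ring

ints-within : ℕ → List ℤ
ints-within K = applyUpTo +_ (suc K) ++ applyUpTo -[1+_] K

∈-ints-within : ∀ K z → ℤ.∣ z ∣ ℕ.≤ K → z ∈ ints-within K
∈-ints-within K (+ n)    ∣z∣≤K = ∈-++⁺ˡ (∈-applyUpTo⁺ +_ (s≤s ∣z∣≤K))
∈-ints-within K -[1+ n ] ∣z∣≤K = ∈-++⁺ʳ (applyUpTo +_ (suc K)) (∈-applyUpTo⁺ -[1+_] ∣z∣≤K)

box-points : ∀ n → ℕ → List (V n)
box-points zero    K = List.[ [] ]
box-points (suc n) K = cartesianProductWith (λ z x → fromℤ z ∷ x) (ints-within K) (box-points n K)

∈-box-points : ∀ n K (x : V n) → Zn x → InBox (fromℤ (+ K)) x → x ∈ box-points n K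
∈-box-points zero    K []       _     _ = here refl
∈-box-points (suc n) K (x₁ ∷ x) x∈ℤⁿ x∈box with x∈ℤⁿ zero
... | z , refl = ∈-cartesianProductWith⁺ (λ z x → fromℤ z ∷ x)
                   (∈-ints-within K z ∣z∣≤K) (∈-box-points n K x (x∈ℤⁿ ∘ suc) (x∈box ∘ suc))
  where
  ∣z∣≤K : ℤ.∣ z ∣ ℕ.≤ K
  ∣z∣≤K with fromℤ-cancel-≤ {+ ℤ.∣ z ∣} {+ K} (subst (_≤ fromℤ (+ K)) (fromℤ-∣∣ z) (x∈box zero))
  ... | ℤ.+≤+ ∣z∣≤K = ∣z∣≤K

short-vectors : ∀ {n} {B : Form n} → IsSymBilinear B → PositiveDefinite B →
                ∀ C → ∃ λ xs → ∀ x → Zn x → B x x ≤ C → x ∈ xs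
short-vectors {n} bil pd C with bounded-norm⇒bounded-coordinates n bil pd C
... | K , inBox = box-points n K , λ x x∈ℤⁿ Bx≤C → ∈-box-points n K x x∈ℤⁿ (inBox x Bx≤C)

ℤⁿ? : ∀ {n} (x : V n) → Dec (Zn x)
ℤⁿ? x = FinP.all? (λ i → isInt? (lookup x i))

ℤⁿ-+ : ∀ {n} (x y : V n) → Zn x → Zn y → Zn (x +v y)
ℤⁿ-+ x y x∈ℤⁿ y∈ℤⁿ i = subst IsInt (sym (VecP.lookup-zipWith _+_ i x y)) (IsInt-+ (x∈ℤⁿ i) (y∈ℤⁿ i))

twice? : ∀ {n} (x : V n) → Dec (Twice Zn x)
twice? x = map′ (λ ½x∈ℤⁿ → ½ · x , ½x∈ℤⁿ , sym (2·½·x≡x x))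
                (λ { (z , z∈ℤⁿ , refl) → subst Zn (sym (½·2·z≡z z)) z∈ℤⁿ })
                (ℤⁿ? (½ · x))
  where
  2·½·x≡x : ∀ {n} (x : V n) → fromℤ (+ 2) · (½ · x) ≡ x
  2·½·x≡x x = trans (·-assoc (fromℤ (+ 2)) ½ x) (·-identityˡ x)
  ½·2·z≡z : ∀ {n} (z : V n) → ½ · (fromℤ (+ 2) · z) ≡ z
  ½·2·z≡z z = trans (·-assoc ½ (fromℤ (+ 2)) z) (·-identityˡ z)

module Subgroup {n} {L : Pred n} (L-subgroup : IsSubgroup L) where

  0∈ : L 0v
  0∈ = proj₁ L-subgroup

  +-closed : ∀ {x y} → L x → L y → L (x +v y)
  +-closed = proj₁ (proj₂ L-subgroup) _ _

  neg-closed : ∀ {x} → L x → L (-v x)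
  neg-closed = proj₂ (proj₂ L-subgroup) _

  ∈-cancelˡ : ∀ {x y} → L x → L (x +v y) → L y
  ∈-cancelˡ {x} {y} x∈L x+y∈L = subst L (+v.\\-leftDividesʳ x y) (+-closed (neg-closed x∈L) x+y∈L)

  vanishing-sum : ∀ {x y} → L x → x +v y ≡ 0v → L y
  vanishing-sum x∈L x+y≡0 = ∈-cancelˡ x∈L (subst L (sym x+y≡0) 0∈)

  ∈-complement⇔ : ∀ {P T : Pred n} → (∀ x → L x × P x → T x) → (∀ x → T x → L x) →
                  ∀ {x l p} → L l → P p → x ≡ l +v p → T p ⇔ L x
  ∈-complement⇔ L∩P⊆T T⊆L {l = l} {p} l∈L p∈P refl =
    mk⇔ (λ p∈T → +-closed l∈L (T⊆L p p∈T)) (λ l+p∈L → L∩P⊆T p (∈-cancelˡ l∈L l+p∈L , p∈P))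

shift₃ : ∀ {n} → V3 n → V n → V3 n
shift₃ (x₁ , x₂ , x₃) y = x₁ +v y , x₂ +v y , x₃ +v y

shift₃-shift₃ : ∀ {n} (w : V3 n) y z → shift₃ (shift₃ w y) z ≡ shift₃ w (y +v z)
shift₃-shift₃ (x₁ , x₂ , x₃) y z = cong₂ _,_ (+v.assoc x₁ y z) (cong₂ _,_ (+v.assoc x₂ y z) (+v.assoc x₃ y z))

shift₃-identityʳ : ∀ {n} (w : V3 n) → shift₃ w 0v ≡ w
shift₃-identityʳ (x₁ , x₂ , x₃) = cong₂ _,_ (+v.identityʳ x₁) (cong₂ _,_ (+v.identityʳ x₂) (+v.identityʳ x₃))

sum₃ : ∀ {n} → V3 n → V n
sum₃ (x₁ , x₂ , x₃) = x₁ +v (x₂ +v x₃)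

sum₃-shift₃ : ∀ {n} (w : V3 n) y → sum₃ (shift₃ w y) ≡ sum₃ w +v (y +v (y +v y))
sum₃-shift₃ (x₁ , x₂ , x₃) y = pointwise x₁ x₂ x₃ y
  where
  regroup : ∀ a b c d → (a + d) + ((b + d) + (c + d)) ≡ (a + (b + c)) + (d + (d + d))
  regroup = solve-∀ ℚ-ring
  pointwise : ∀ {m} (x₁ x₂ x₃ y : V m) → sum₃ (shift₃ (x₁ , x₂ , x₃) y) ≡ sum₃ (x₁ , x₂ , x₃) +v (y +v (y +v y))
  pointwise []       []       []       []       = refl
  pointwise (a ∷ x₁) (b ∷ x₂) (c ∷ x₃) (d ∷ y) = cong₂ _∷_ (regroup a b c d) (pointwise x₁ x₂ x₃ y)

module _ {n} {M N : Pred n} where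

  L3⇒shift₃ : ∀ {w} → L3 M N w → ∃₂ λ a y → L_M M N a × N y × w ≡ shift₃ a y
  L3⇒shift₃ (a , _ , a∈L_M , (y , y∈N , refl , refl , refl) , w≡a+y) = a , y , a∈L_M , y∈N , w≡a+y

  shift₃∈L3 : ∀ {a y} → L_M M N a → N y → L3 M N (shift₃ a y)
  shift₃∈L3 {a} {y} a∈L_M y∈N = a , (y , y , y) , a∈L_M , (y , y∈N , refl , refl , refl) , refl

module _ {n} {M N : Pred n} (M-subgroup : IsSubgroup M) (N-subgroup : IsSubgroup N) where
  private
    module M = Subgroup M-subgroup
    module N = Subgroup N-subgroup

  L_M-shift : ∀ {a d} → M d → N d → L_M M N a → L_M M N (shift₃ a d)
  L_M-shift {a} {d} d∈M d∈N (x₁∈M , x₂∈M , x₃∈M , s∈M , s∈N) =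
      M.+-closed x₁∈M d∈M , M.+-closed x₂∈M d∈M , M.+-closed x₃∈M d∈M
    , subst M (sym (sum₃-shift₃ a d)) (M.+-closed s∈M (M.+-closed d∈M (M.+-closed d∈M d∈M)))
    , subst N (sym (sum₃-shift₃ a d)) (N.+-closed s∈N (N.+-closed d∈N (N.+-closed d∈N d∈N)))

L3⊆ℤⁿ³ : ∀ {n} {M N : Pred n} → M ⊆ Zn → N ⊆ Zn → ∀ {v₁ v₂ v₃} → L3 M N (v₁ , v₂ , v₃) → Zn v₁ × Zn v₂ × Zn v₃
L3⊆ℤⁿ³ {M = M} M⊆ℤⁿ N⊆ℤⁿ w∈L3 with L3⇒shift₃ w∈L3
... | (x₁ , x₂ , x₃) , y , (x₁∈M , x₂∈M , x₃∈M , _) , y∈N , refl = component x₁∈M , component x₂∈M , component x₃∈M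
  where
  component : ∀ {x} → M x → Zn (x +v y)
  component {x} x∈M = ℤⁿ-+ x y (M⊆ℤⁿ x x∈M) (N⊆ℤⁿ y y∈N)

module Polarization {n} {M N : Pred n} (M-subgroup : IsSubgroup M) (N-subgroup : IsSubgroup N)
  (M⊆ℤⁿ : M ⊆ Zn) (N⊆ℤⁿ : N ⊆ Zn) (M+N : ∀ x → Zn x → ∃₂ λ m k → M m × N k × x ≡ m +v k)
  (M∩N⊆2ℤⁿ : ∀ x → M x × N x → Twice Zn x) (2ℤⁿ⊆M∩N : ∀ x → Twice Zn x → M x × N x) where

  private
    module M = Subgroup M-subgroup
    module N = Subgroup N-subgroup

  M? : ∀ x → Dec (M x)
  M? x with ℤⁿ? x
  ... | no x∉ℤⁿ = no (x∉ℤⁿ ∘ M⊆ℤⁿ x)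
  ... | yes x∈ℤⁿ with M+N x x∈ℤⁿ
  ... | m , k , m∈M , k∈N , x≡m+k =
        Dec.map (M.∈-complement⇔ M∩N⊆2ℤⁿ (λ z → proj₁ ∘ 2ℤⁿ⊆M∩N z) m∈M k∈N x≡m+k) (twice? k)

  N? : ∀ x → Dec (N x)
  N? x with ℤⁿ? x
  ... | no x∉ℤⁿ = no (x∉ℤⁿ ∘ N⊆ℤⁿ x)
  ... | yes x∈ℤⁿ with M+N x x∈ℤⁿ
  ... | m , k , m∈M , k∈N , x≡m+k =
        Dec.map (N.∈-complement⇔ (λ z → M∩N⊆2ℤⁿ z ∘ swap) (λ z → proj₂ ∘ 2ℤⁿ⊆M∩N z) k∈N m∈M
                                 (trans x≡m+k (+v.comm m k)))
                (twice? m)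

  L_M? : ∀ w → Dec (L_M M N w)
  L_M? (x₁ , x₂ , x₃) = M? x₁ ×-dec M? x₂ ×-dec M? x₃ ×-dec M? (sum₃ (x₁ , x₂ , x₃)) ×-dec N? (sum₃ (x₁ , x₂ , x₃))

  L3⇒unshifted∈L_M : ∀ {w m k} → L3 M N w → M m → N k → proj₁ w ≡ m +v k → L_M M N (shift₃ w (-v k))
  L3⇒unshifted∈L_M {m = m} {k} w∈L3 m∈M k∈N v₁≡m+k with L3⇒shift₃ w∈L3
  ... | a@(x₁ , _ , _) , y , a∈L_M@(x₁∈M , _) , y∈N , refl =
        subst (L_M M N) (sym (shift₃-shift₃ a y (-v k))) (L_M-shift M-subgroup N-subgroup d∈M d∈N a∈L_M)
    where
    d∈N : N (y +v (-v k))
    d∈N = N.+-closed y∈N (N.neg-closed k∈N)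
    x₁+d≡m : x₁ +v (y +v (-v k)) ≡ m
    x₁+d≡m = trans (sym (+v.assoc x₁ y (-v k))) (trans (cong (_+v (-v k)) v₁≡m+k) (+v.//-rightDividesʳ k m))
    d∈M : M (y +v (-v k))
    d∈M = M.∈-cancelˡ x₁∈M (subst M (sym x₁+d≡m) m∈M)

  L3? : ∀ w → Dec (L3 M N w)
  L3? w with ℤⁿ? (proj₁ w)
  ... | no v₁∉ℤⁿ = no (v₁∉ℤⁿ ∘ proj₁ ∘ L3⊆ℤⁿ³ M⊆ℤⁿ N⊆ℤⁿ)
  ... | yes v₁∈ℤⁿ with M+N (proj₁ w) v₁∈ℤⁿ
  ... | m , k , m∈M , k∈N , v₁≡m+k =
        map′ (λ w-k∈L_M → subst (L3 M N) shift-back (shift₃∈L3 w-k∈L_M k∈N))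
             (λ w∈L3 → L3⇒unshifted∈L_M w∈L3 m∈M k∈N v₁≡m+k)
             (L_M? (shift₃ w (-v k)))
    where
    shift-back : shift₃ (shift₃ w (-v k)) k ≡ w
    shift-back = trans (shift₃-shift₃ w (-v k) k) (trans (cong (shift₃ w) (+v.inverseˡ k)) (shift₃-identityʳ w))

_≟v_ : ∀ {n} (x y : V n) → Dec (x ≡ y)
_≟v_ = VecP.≡-dec ℚP._≟_

+-mono-≤₃ : ∀ {a b c A B C} → A ≤ a → B ≤ b → C ≤ c → A + (B + C) ≤ a + (b + c)
+-mono-≤₃ A≤a B≤b C≤c = ℚP.+-mono-≤ A≤a (ℚP.+-mono-≤ B≤b C≤c)

module _ {n} {H : Form n} (H-bil : IsSymBilinear H) (H-pd : PositiveDefinite H) where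
  open IsSymBilinear H-bil

  private
    0≤H : ∀ x → 0ℚ ≤ H x x
    0≤H = norm-nonNeg H-bil H-pd

  twice-norm≥8 : (∀ x → Zn x → x ≢ 0v → fromℤ (+ 2) ≤ H x x) →
                 ∀ x → Twice Zn x → x ≢ 0v → fromℤ (+ 8) ≤ H x x
  twice-norm≥8 ℤⁿ-min x (z , z∈ℤⁿ , refl) x≢0 =
    subst (fromℤ (+ 8) ≤_) (sym (norm-scale (fromℤ (+ 2)) z))
      (*-monoˡ-≤-nonNeg (fromℤ (+ 2)) (0≤fromℤ+ 2)
        (*-monoˡ-≤-nonNeg (fromℤ (+ 2)) (0≤fromℤ+ 2) (ℤⁿ-min z z∈ℤⁿ z≢0)))
    where
    z≢0 : z ≢ 0v
    z≢0 refl = x≢0 (·-zeroʳ (fromℤ (+ 2)))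

  module _ {M : Pred n}
    (ℤⁿ-min : ∀ x → Zn x → x ≢ 0v → fromℤ (+ 2) ≤ H x x)
    (M-min : ∀ x → M x → x ≢ 0v → fromℤ (+ 4) ≤ H x x) where

    private
      2ℤⁿ-min : ∀ x → Twice Zn x → x ≢ 0v → fromℤ (+ 8) ≤ H x x
      2ℤⁿ-min = twice-norm≥8 ℤⁿ-min

    norm≥8-of-triple : ∀ p q r → M p → M q → M r → Twice Zn (sum₃ (p , q , r)) → (p , q , r) ≢ 0v3 →
                       fromℤ (+ 8) ≤ norm3 H (p , q , r)
    norm≥8-of-triple p q r p∈M q∈M r∈M s∈2ℤⁿ w≢0 with p ≟v 0v | q ≟v 0v | r ≟v 0v
    ... | no p≢0   | no q≢0   | _        = +-mono-≤₃ (M-min p p∈M p≢0) (M-min q q∈M q≢0) (0≤H r)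
    ... | no p≢0   | yes refl | no r≢0   = +-mono-≤₃ (M-min p p∈M p≢0) (0≤H 0v) (M-min r r∈M r≢0)
    ... | yes refl | no q≢0   | no r≢0   = +-mono-≤₃ (0≤H 0v) (M-min q q∈M q≢0) (M-min r r∈M r≢0)
    ... | no p≢0   | yes refl | yes refl = +-mono-≤₃ (2ℤⁿ-min p p∈2ℤⁿ p≢0) (0≤H 0v) (0≤H 0v)
      where
      p∈2ℤⁿ : Twice Zn p
      p∈2ℤⁿ = subst (Twice Zn) (trans (cong (p +v_) (+v.identityˡ 0v)) (+v.identityʳ p)) s∈2ℤⁿ
    ... | yes refl | no q≢0   | yes refl = +-mono-≤₃ (0≤H 0v) (2ℤⁿ-min q q∈2ℤⁿ q≢0) (0≤H 0v)
      where
      q∈2ℤⁿ : Twice Zn q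
      q∈2ℤⁿ = subst (Twice Zn) (trans (+v.identityˡ (q +v 0v)) (+v.identityʳ q)) s∈2ℤⁿ
    ... | yes refl | yes refl | no r≢0   = +-mono-≤₃ (0≤H 0v) (0≤H 0v) (2ℤⁿ-min r r∈2ℤⁿ r≢0)
      where
      r∈2ℤⁿ : Twice Zn r
      r∈2ℤⁿ = subst (Twice Zn) (trans (+v.identityˡ (0v +v r)) (+v.identityˡ r)) s∈2ℤⁿ
    ... | yes refl | yes refl | yes refl = ⊥-elim (w≢0 refl)

    module _ {N : Pred n} (M-subgroup : IsSubgroup M) (N-subgroup : IsSubgroup N)
      (M⊆ℤⁿ : M ⊆ Zn) (N⊆ℤⁿ : N ⊆ Zn) (M∩N⊆2ℤⁿ : ∀ x → M x × N x → Twice Zn x) where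

      private
        module M = Subgroup M-subgroup

      L_M-norm≥8 : ∀ w → L_M M N w → w ≢ 0v3 → fromℤ (+ 8) ≤ norm3 H w
      L_M-norm≥8 w@(p , q , r) (p∈M , q∈M , r∈M , s∈M , s∈N) =
        norm≥8-of-triple p q r p∈M q∈M r∈M (M∩N⊆2ℤⁿ (sum₃ w) (s∈M , s∈N))

      shift-by-M-norm≥6 : ∀ {a y} → L_M M N a → M y → N y → shift₃ a y ≢ 0v3 →
                          fromℤ (+ 6) ≤ norm3 H (shift₃ a y)
      shift-by-M-norm≥6 a∈L_M y∈M y∈N =
        ℚP.≤-trans (fromℤ-mono-≤ (ℤ.+≤+ (ℕP.m≤m+n 6 2)))
        ∘ L_M-norm≥8 _ (L_M-shift M-subgroup N-subgroup y∈M y∈N a∈L_M)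

      L3-norm≥6 : ∀ w → L3 M N w → w ≢ 0v3 → fromℤ (+ 6) ≤ norm3 H w
      L3-norm≥6 w w∈L3 with L3⇒shift₃ w∈L3
      ... | (x₁ , x₂ , x₃) , y , a∈L_M@(x₁∈M , x₂∈M , x₃∈M , _) , y∈N , refl
          with (x₁ +v y) ≟v 0v | (x₂ +v y) ≟v 0v | (x₃ +v y) ≟v 0v
      ... | yes v₁≡0 | _         | _         = shift-by-M-norm≥6 a∈L_M (M.vanishing-sum x₁∈M v₁≡0) y∈N
      ... | no _     | yes v₂≡0  | _         = shift-by-M-norm≥6 a∈L_M (M.vanishing-sum x₂∈M v₂≡0) y∈N
      ... | no _     | no _      | yes v₃≡0  = shift-by-M-norm≥6 a∈L_M (M.vanishing-sum x₃∈M v₃≡0) y∈N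
      ... | no v₁≢0  | no v₂≢0   | no v₃≢0   = λ _ →
            +-mono-≤₃ (ℤⁿ-min _ (component-ℤⁿ x₁∈M) v₁≢0) (ℤⁿ-min _ (component-ℤⁿ x₂∈M) v₂≢0)
                      (ℤⁿ-min _ (component-ℤⁿ x₃∈M) v₃≢0)
        where
        component-ℤⁿ : ∀ {x} → M x → Zn (x +v y)
        component-ℤⁿ {x} x∈M = ℤⁿ-+ x y (M⊆ℤⁿ x x∈M) (N⊆ℤⁿ y y∈N)

module _ {n} {H : Form n} (H-bil : IsSymBilinear H) where
  open IsSymBilinear H-bil

  norm3-shift₃ : ∀ a y → norm3 H (shift₃ a y) ≡
                 norm3 H a + ((H (sum₃ a) y + H (sum₃ a) y) + (H y y + (H y y + H y y)))
  norm3-shift₃ a@(x₁ , x₂ , x₃) y = begin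
    norm3 H (shift₃ a y)
      ≡⟨ cong₂ _+_ (norm-+ x₁ y) (cong₂ _+_ (norm-+ x₂ y) (norm-+ x₃ y)) ⟩
    (H x₁ x₁ + ((H x₁ y + H x₁ y) + H y y)) + ((H x₂ x₂ + ((H x₂ y + H x₂ y) + H y y)) + (H x₃ x₃ + ((H x₃ y + H x₃ y) + H y y)))
      ≡⟨ collect (H x₁ x₁) (H x₂ x₂) (H x₃ x₃) (H x₁ y) (H x₂ y) (H x₃ y) (H y y) ⟩
    norm3 H a + (((H x₁ y + (H x₂ y + H x₃ y)) + (H x₁ y + (H x₂ y + H x₃ y))) + (H y y + (H y y + H y y)))
      ≡⟨ cong (λ t → norm3 H a + ((t + t) + (H y y + (H y y + H y y)))) (sym H-sum₃) ⟩
    norm3 H a + ((H (sum₃ a) y + H (sum₃ a) y) + (H y y + (H y y + H y y))) ∎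
    where
    open ≡-Reasoning
    H-sum₃ : H (sum₃ a) y ≡ H x₁ y + (H x₂ y + H x₃ y)
    H-sum₃ = trans (addˡ x₁ _ y) (cong (λ t → H x₁ y + t) (addˡ x₂ x₃ y))
    collect : ∀ a b c p q r t →
      (a + ((p + p) + t)) + ((b + ((q + q) + t)) + (c + ((r + r) + t))) ≡
      (a + (b + c)) + (((p + (q + r)) + (p + (q + r))) + (t + (t + t)))
    collect = solve-∀ ℚ-ring

  L3-norm-even : ∀ {M N : Pred n} → Even H M → Even H N → Integral H N →
                 ∀ w → L3 M N w → IsEvenInt (norm3 H w)
  L3-norm-even M-even N-even N-integral w w∈L3 with L3⇒shift₃ w∈L3
  ... | a@(x₁ , x₂ , x₃) , y , (x₁∈M , x₂∈M , x₃∈M , _ , s∈N) , y∈N , refl =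
    subst IsEvenInt (sym (norm3-shift₃ a y))
      (IsEvenInt-+ (IsEvenInt-+ (M-even x₁ x₁∈M) (IsEvenInt-+ (M-even x₂ x₂∈M) (M-even x₃ x₃∈M)))
                   (IsEvenInt-+ (IsEvenInt-double (N-integral (sum₃ a) y s∈N y∈N))
                                (IsEvenInt-+ Hy-even (IsEvenInt-+ Hy-even Hy-even))))
    where
    Hy-even : IsEvenInt (H y y)
    Hy-even = N-even y y∈N

  module _ {M N : Pred n} (M-subgroup : IsSubgroup M) (N-subgroup : IsSubgroup N) where
    private
      module M = Subgroup M-subgroup
      module N = Subgroup N-subgroup

    L_M⊆L3 : ∀ {a} → L_M M N a → L3 M N a
    L_M⊆L3 {a} a∈L_M = subst (L3 M N) (shift₃-identityʳ a) (shift₃∈L3 a∈L_M N.0∈)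

    L3-vector-of-twice-norm : ∀ {x} → M x → x ≢ 0v →
                              ∃ λ w → L3 M N w × w ≢ 0v3 × norm3 H w ≡ H x x + H x x
    L3-vector-of-twice-norm {x} x∈M x≢0 =
        (x , -v x , 0v)
      , L_M⊆L3 (x∈M , M.neg-closed x∈M , M.0∈ , subst M (sym sum≡0) M.0∈ , subst N (sym sum≡0) N.0∈)
      , x≢0 ∘ cong proj₁
      , cong (λ t → H x x + t) (trans (cong (_+ H 0v 0v) (norm-neg x)) (trans (cong (λ t → H x x + t) (zeroˡ 0v)) (ℚP.+-identityʳ (H x x))))
      where
      sum≡0 : x +v ((-v x) +v 0v) ≡ 0v
      sum≡0 = trans (cong (x +v_) (+v.identityʳ (-v x))) (+v.inverseʳ x)

2n≥6∧2n≢6⇒2n≥8 : ∀ n → 6 ℕ.≤ 2 ℕ.* n → 2 ℕ.* n ≢ 6 → 8 ℕ.≤ 2 ℕ.* n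
2n≥6∧2n≢6⇒2n≥8 0 () _
2n≥6∧2n≢6⇒2n≥8 1 (s≤s (s≤s ())) _
2n≥6∧2n≢6⇒2n≥8 2 (s≤s (s≤s (s≤s (s≤s ())))) _
2n≥6∧2n≢6⇒2n≥8 3 _ 6≢6 = ⊥-elim (6≢6 refl)
2n≥6∧2n≢6⇒2n≥8 (suc (suc (suc (suc k)))) _ _ = ℕP.*-monoʳ-≤ 2 (s≤s (s≤s (s≤s (s≤s z≤n))))

even≥6∧≢6⇒≥8 : ∀ {q} → IsEvenInt q → fromℤ (+ 6) ≤ q → q ≢ fromℤ (+ 6) → fromℤ (+ 8) ≤ q
even≥6∧≢6⇒≥8 (+ n , refl) 6≤q q≢6 rewrite sym (ℤP.pos-* 2 n) =
  fromℤ-mono-≤ (ℤ.+≤+ (2n≥6∧2n≢6⇒2n≥8 n 6≤2n (q≢6 ∘ cong (λ m → fromℤ (+ m)))))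
  where
  6≤2n : 6 ℕ.≤ 2 ℕ.* n
  6≤2n with fromℤ-cancel-≤ {+ 6} {+ (2 ℕ.* n)} 6≤q
  ... | ℤ.+≤+ 6≤2n = 6≤2n
even≥6∧≢6⇒≥8 (-[1+ n ] , refl) 6≤q _ with fromℤ-cancel-≤ {+ 6} {+ 2 ℤ.* -[1+ n ]} 6≤q
... | ()

hasMin-6⊎8 : {W : Set} {0w : W} {‖_‖ : W → ℚ} {L : W → Set} →
             (∀ w → Dec (L w)) → DecidableEquality W →
             (∃ λ ws → ∀ w → L w → ‖ w ‖ ≡ fromℤ (+ 6) → w ∈ ws) →
             (∀ w → L w → w ≢ 0w → fromℤ (+ 6) ≤ ‖ w ‖) →
             (∀ w → L w → IsEvenInt ‖ w ‖) →
             (∃ λ w → L w × w ≢ 0w × ‖ w ‖ ≡ fromℤ (+ 8)) →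
             HasMin 0w ‖_‖ L (fromℤ (+ 6)) ⊎ HasMin 0w ‖_‖ L (fromℤ (+ 8))
hasMin-6⊎8 {0w = 0w} {‖_‖} {L} L? _≟_ (ws , ws-covers) norm≥6 norm-even norm8
  with any? (λ w → L? w ×-dec ¬? (w ≟ 0w) ×-dec (‖ w ‖ ℚP.≟ fromℤ (+ 6))) ws
... | yes ∃norm6 = inj₁ (norm≥6 , satisfied ∃norm6)
... | no  ∄norm6 = inj₂ (norm≥8 , norm8)
  where
  norm≥8 : ∀ w → L w → w ≢ 0w → fromℤ (+ 8) ≤ ‖ w ‖
  norm≥8 w w∈L w≢0 = even≥6∧≢6⇒≥8 (norm-even w w∈L) (norm≥6 w w∈L w≢0)
    (λ ‖w‖≡6 → ∄norm6 (lose (ws-covers w w∈L ‖w‖≡6) (w∈L , w≢0 , ‖w‖≡6)))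

short-vectors³ : ∀ {n} {H : Form n} → IsSymBilinear H → PositiveDefinite H → ∀ C →
                 ∃ λ ws → ∀ {v₁ v₂ v₃} → Zn v₁ × Zn v₂ × Zn v₃ → norm3 H (v₁ , v₂ , v₃) ≤ C → (v₁ , v₂ , v₃) ∈ ws
short-vectors³ {H = H} bil pd C with short-vectors bil pd C
... | xs , xs-covers = cartesianProduct xs (cartesianProduct xs xs) , covers
  where
  0≤H : ∀ x → 0ℚ ≤ H x x
  0≤H = norm-nonNeg bil pd
  covers : ∀ {v₁ v₂ v₃} → Zn v₁ × Zn v₂ × Zn v₃ → norm3 H (v₁ , v₂ , v₃) ≤ C →
           (v₁ , v₂ , v₃) ∈ cartesianProduct xs (cartesianProduct xs xs)
  covers {v₁} {v₂} {v₃} (v₁∈ℤⁿ , v₂∈ℤⁿ , v₃∈ℤⁿ) ‖w‖≤C =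
    ∈-cartesianProduct⁺ (xs-covers v₁ v₁∈ℤⁿ (ℚP.≤-trans H₁≤‖w‖ ‖w‖≤C))
      (∈-cartesianProduct⁺ (xs-covers v₂ v₂∈ℤⁿ (ℚP.≤-trans H₂≤‖w‖ ‖w‖≤C)) (xs-covers v₃ v₃∈ℤⁿ (ℚP.≤-trans H₃≤‖w‖ ‖w‖≤C)))
    where
    H₁≤‖w‖ : H v₁ v₁ ≤ norm3 H (v₁ , v₂ , v₃)
    H₁≤‖w‖ = ≤-+-nonNegʳ (ℚP.+-mono-≤ (0≤H v₂) (0≤H v₃))
    H₂≤‖w‖ : H v₂ v₂ ≤ norm3 H (v₁ , v₂ , v₃)
    H₂≤‖w‖ = ℚP.≤-trans (≤-+-nonNegʳ (0≤H v₃)) (≤-+-nonNegˡ (0≤H v₁))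
    H₃≤‖w‖ : H v₃ v₃ ≤ norm3 H (v₁ , v₂ , v₃)
    H₃≤‖w‖ = ℚP.≤-trans (≤-+-nonNegˡ (0≤H v₂)) (≤-+-nonNegˡ (0≤H v₁))

halfForm-positiveDefinite : ∀ {n} {B : Form n} → PositiveDefinite B → PositiveDefinite (halfForm B)
halfForm-positiveDefinite {B = B} pd x x≢0 =
  ℚP.positive⁻¹ (½ * B x x) {{ℚP.pos*pos⇒pos ½ (B x x) {{ℚ.positive (pd x x≢0)}}}}

L3-hasMin-6⊎8 : ∀ {n} {H : Form n} {M N : Pred n} → IsSymBilinear H → PositiveDefinite H →
                (∀ x → Zn x → x ≢ 0v → fromℤ (+ 2) ≤ H x x) →
                IsPolarization H Zn M N → Even H M → Even H N → Integral H N → MinNorm H M (fromℤ (+ 4)) →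
                HasMin 0v3 (norm3 H) (L3 M N) (fromℤ (+ 6)) ⊎ HasMin 0v3 (norm3 H) (L3 M N) (fromℤ (+ 8))
L3-hasMin-6⊎8 {H = H} {M} {N} H-bil H-pd ℤⁿ-min
  (M-subgroup , N-subgroup , M⊆ℤⁿ , N⊆ℤⁿ , _ , _ , M+N , M∩N⊆2ℤⁿ , 2ℤⁿ⊆M∩N)
  M-even N-even N-integral (M-min , x , x∈M , x≢0 , ‖x‖≡4)
  with short-vectors³ H-bil H-pd (fromℤ (+ 6))
... | ws , ws-covers =
  hasMin-6⊎8 L3? (ProductP.≡-dec _≟v_ (ProductP.≡-dec _≟v_ _≟v_))
    (ws , λ _ w∈L3 ‖w‖≡6 → ws-covers (L3⊆ℤⁿ³ M⊆ℤⁿ N⊆ℤⁿ w∈L3) (ℚP.≤-reflexive ‖w‖≡6))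
    (L3-norm≥6 H-bil H-pd ℤⁿ-min M-min M-subgroup N-subgroup M⊆ℤⁿ N⊆ℤⁿ M∩N⊆2ℤⁿ)
    (L3-norm-even H-bil M-even N-even N-integral)
    (subst (λ h → ∃ λ w → L3 M N w × w ≢ 0v3 × norm3 H w ≡ h + h) ‖x‖≡4
           (L3-vector-of-twice-norm H-bil M-subgroup N-subgroup x∈M x≢0))
  where open Polarization M-subgroup N-subgroup M⊆ℤⁿ N⊆ℤⁿ M+N M∩N⊆2ℤⁿ 2ℤⁿ⊆M∩N using (L3?)

proposition5p2 : (G : Matrix 32) →
    Symmetric (formOf G) → PositiveDefinite (formOf G) →
    EvenUnimodular (formOf G) Zn → MinNorm (formOf G) Zn (+ 4 / 1) →
    (M N : Pred 32) →
    IsPolarization (halfForm (formOf G)) Zn M N →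
    EvenUnimodular (halfForm (formOf G)) M →
    EvenUnimodular (halfForm (formOf G)) N →
    MinNorm (halfForm (formOf G)) M (+ 4 / 1) →
    (MinNorm (halfForm (formOf G)) N (+ 2 / 1) ⊎ MinNorm (halfForm (formOf G)) N (+ 4 / 1)) →
    HasMin 0v3 (norm3 (halfForm (formOf G))) (L3 M N) (+ 6 / 1)
      ⊎ HasMin 0v3 (norm3 (halfForm (formOf G))) (L3 M N) (+ 8 / 1)
proposition5p2 G G-sym G-pd _ (ℤⁿ-min₄ , _) M N polarization (M-even , _) (N-even , N-integral , _) M-min _ =
  L3-hasMin-6⊎8 (halfForm-isSymBilinear (formOf-isSymBilinear G G-sym)) (halfForm-positiveDefinite {B = formOf G} G-pd)
    ℤⁿ-min polarization M-even N-even N-integral M-min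
  where
  ℤⁿ-min : ∀ x → Zn x → x ≢ 0v → fromℤ (+ 2) ≤ halfForm (formOf G) x x
  ℤⁿ-min x x∈ℤⁿ x≢0 = *-monoˡ-≤-nonNeg ½ (ℚP.nonNegative⁻¹ ½) (ℤⁿ-min₄ x x∈ℤⁿ x≢0)
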